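{- For every $n\in\mathbb{N}$, the function $F_n$ induces a decomposable orientation of the hypercube $\{0,1\}^n$: the values of $F_n$ at the two endpoints of every edge of the hypercube graph differ, and the orientation $\sigma$ directing each edge $\{\mathbf{x},\mathbf{y}\}$ from the endpoint with smaller $F_n$-value to the endpoint with larger $F_n$-value is decomposable.
   Context: For $n\in\mathbb{N}$ and $\mathbf{x}=(x_1,\dots,x_n)^\top\in\mathbb{R}^n$, set $x_0:=1$, $\alpha_{n,n+1}(\mathbf{x})=0$, and for $i\in[n]=\{1,\dots,n\}$: $\alpha_{n,i}(\mathbf{x})=x_i+(1-2x_i)\alpha_{n,i+1}(\mathbf{x})$ and $\beta_{n,i}(\mathbf{x})=2^i(x_i-x_i^2)\bigl(1-x_{i-1}+\sum_{j=1}^{i-2}x_j\bigr)$. Define $F_n(\mathbf{x})=\sum_{i=1}^n\bigl(2^{i-1}\alpha_{n,i}(\mathbf{x})-\beta_{n,i}(\mathbf{x})\bigr)$. The hypercube graph has vertex set $\{0,1\}^n$ and edges between vectors differing in exactly one coordinate. A subcube is a set $\mathcal{S}=\{\mathbf{x}\in\{0,1\}^n: x_i=\delta_i\ \forall i\notin I\}$ for some $I\subseteq[n]$ and fixed $\delta_i\in\{0,1\}$; its dimension is $|I|$. An orientation $\sigma$ of the edges is combed on $\mathcal{S}$ if there is a dimension $i\in I$ and $\delta\in\{0,1\}$ such that for all $\mathbf{x}\in\mathcal{S}$ with $x_i=\delta$ the edge $\{\mathbf{x},\mathbf{x}+(1-2x_i)\mathbf{e}^i\}$ is directed from $\mathbf{x}$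 to $\mathbf{x}+(1-2x_i)\mathbf{e}^i$. An orientation is decomposable if it is combed on every subcube of nonzero dimension. -}

module Defs where

open import Data.Bool using (Bool; true; false; not; if_then_else_)
open import Data.Nat as ℕ using (ℕ; zero; suc; _∸_; _<?_)
open import Data.Integer as ℤ using (ℤ; 0ℤ; 1ℤ; _+_; _-_; _*_; _^_; _<_)
open import Data.Fin using (Fin; fromℕ<; _≟_)
open import Data.Fin.Subset using (Subset; _∈_; _∉_; Nonempty)
open import Data.Product using (Σ; ∃; _×_; _,_)
open import Relation.Nullary using (yes; no; ⌊_⌋)
open import Relation.Binary.PropositionalEquality using (_≡_)

Vertex : ℕ → Set
Vertex n = Fin n → Bool

b2z : Bool → ℤ
b2z true  = 1ℤ
b2z false = 0ℤ

-- coordinates x_i as integers, 1-indexed, with the convention x_0 = 1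
-- (indices > n are never used; set to 0)
coord : {n : ℕ} → Vertex n → ℕ → ℤ
coord x zero = 1ℤ
coord {n} x (suc k) with k <? n
... | yes p = b2z (x (fromℕ< p))
... | no _  = 0ℤ

sumFrom : (ℕ → ℤ) → ℕ → ℕ → ℤ
sumFrom f a zero    = 0ℤ
sumFrom f a (suc k) = f a + sumFrom f (suc a) k

two : ℤ
two = ℤ.+ 2

-- αaux x k i = α_{n,i} when k = n + 1 - i  (αaux x 0 (n+1) = α_{n,n+1} = 0)
αaux : (ℕ → ℤ) → ℕ → ℕ → ℤ
αaux x zero    i = 0ℤ
αaux x (suc k) i = x i + (1ℤ - two * x i) * αaux x k (suc i)

α : (n : ℕ) → (ℕ → ℤ) → ℕ → ℤ
α n x i = αaux x (suc n ∸ i) i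

β : (ℕ → ℤ) → ℕ → ℤ
β x i = (two ^ i) * (x i - x i * x i) * (1ℤ - x (i ∸ 1) + sumFrom x 1 (i ∸ 2))

F : (n : ℕ) → Vertex n → ℤ
F n v = sumFrom (λ i → (two ^ (i ∸ 1)) * α n x i - β x i) 1 n
  where x = coord v

flipAt : {n : ℕ} → Vertex n → Fin n → Vertex n
flipAt x i j = if ⌊ j ≟ i ⌋ then not (x j) else x j

-- An orientation is given by the relation "edge {x,y} is directed from x to y"
Orientation : ℕ → Set₁
Orientation n = Vertex n → Vertex n → Set

InSubcube : {n : ℕ} → Subset n → Vertex n → Vertex n → Set
InSubcube I δ x = ∀ i → i ∉ I → x i ≡ δ i

Combed : {n : ℕ} → Orientation n → Subset n → Vertex n → Set
Combed σ I δ = ∃ λ i → i ∈ I × ∃ λ (d : Bool) →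
  ∀ x → InSubcube I δ x → x i ≡ d → σ x (flipAt x i)

Decomposable : {n : ℕ} → Orientation n → Set
Decomposable {n} σ = (I : Subset n) (δ : Vertex n) → Nonempty I → Combed σ I δ

σF : (n : ℕ) → Orientation n
σF n x y = F n x < F n y

{-# OPTIONS --safe #-}
module Submission where

-- At a vertex every β_{n,i} vanishes (x_i - x_i² = 0) and α_{n,i} is the parity
-- x_i ⊕ ⋯ ⊕ x_n, so F_n(x) is the natural number whose binary digits are
-- α_{n,1}, …, α_{n,n}.  Flipping x_p toggles exactly the digits α_{n,i} with i ≤ p,
-- so the most significant changed digit is α_{n,p}: the flip increases F_n iff
-- α_{n,p}(x) = 0.  On a subcube whose largest free dimension is p, the parity
-- α_{n,p+1} = d is constant, hence all edges in direction p leave the facet x_p = d.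

open import Defs
open import Data.Bool using (Bool; true; false; not; _xor_)
open import Data.Bool.Properties using (not-involutive; not-distribˡ-xor; xor-same)
open import Data.Nat as ℕ using (ℕ; zero; suc; _+_; _*_; _^_; _∸_; _<?_; _≟_; _≤_; _<_; s≤s; z≤n)
import Data.Nat.Properties as ℕₚ
open import Data.Integer as ℤ using (ℤ; 0ℤ; 1ℤ; +_; +<+)
import Data.Integer.Properties as ℤₚ
open import Data.Fin as Fin using (Fin; fromℕ<; toℕ)
import Data.Fin.Properties as Finₚ
open import Data.Fin.Subset using (Subset; _∈_; _∉_; Nonempty)
open import Data.Fin.Subset.Properties using (nonempty?)
open import Data.Vec using (_∷_; here; there)
open import Data.Product using (∃; _×_; _,_)
open import Data.Empty using (⊥-elim)
open import Relation.Nullary using (yes; no)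
open import Relation.Binary.PropositionalEquality

bit : {n : ℕ} → Vertex n → ℕ → Bool
bit x zero = true
bit {n} x (suc k) with k <? n
... | yes k<n = x (fromℕ< k<n)
... | no _    = false

coord≡b2z∘bit : {n : ℕ} (x : Vertex n) (k : ℕ) → coord x k ≡ b2z (bit x k)
coord≡b2z∘bit x zero = refl
coord≡b2z∘bit {n} x (suc k) with k <? n
... | yes _ = refl
... | no _  = refl

bit-suc-toℕ : {n : ℕ} (x : Vertex n) (i : Fin n) → bit x (suc (toℕ i)) ≡ x i
bit-suc-toℕ {n} x i with toℕ i <? n
... | yes i<n = cong x (Finₚ.fromℕ<-toℕ i i<n)
... | no i≮n  = ⊥-elim (i≮n (Finₚ.toℕ<n i))

DiffersOnlyAt : (ℕ → Bool) → (ℕ → Bool) → ℕ → Set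
DiffersOnlyAt c c′ p = (∀ k → k ≢ p → c′ k ≡ c k) × c′ p ≡ not (c p)

differsOnlyAt-sym : {c c′ : ℕ → Bool} {p : ℕ} → DiffersOnlyAt c c′ p → DiffersOnlyAt c′ c p
differsOnlyAt-sym {c} {c′} {p} (same , flipped) =
  (λ k k≢p → sym (same k k≢p)) ,
  (begin
    c p             ≡⟨ not-involutive (c p) ⟨
    not (not (c p)) ≡⟨ cong not flipped ⟨
    not (c′ p)      ∎)
  where open ≡-Reasoning

bit-flipAt : {n : ℕ} (x : Vertex n) (j : Fin n) →
  DiffersOnlyAt (bit x) (bit (flipAt x j)) (suc (toℕ j))
bit-flipAt {n} x j = same , flipped
  where
  same : ∀ k → k ≢ suc (toℕ j) → bit (flipAt x j) k ≡ bit x k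
  same zero _ = refl
  same (suc k) k≢j with k <? n
  ... | no _ = refl
  ... | yes k<n with fromℕ< k<n Fin.≟ j
  ...   | yes k≡j = ⊥-elim (k≢j (cong suc (trans (sym (Finₚ.toℕ-fromℕ< k<n)) (cong toℕ k≡j))))
  ...   | no _    = refl

  flipped : bit (flipAt x j) (suc (toℕ j)) ≡ not (bit x (suc (toℕ j)))
  flipped with j Fin.≟ j | bit-suc-toℕ (flipAt x j) j | bit-suc-toℕ x j
  ... | yes _  | flipped-j | x-j = trans flipped-j (cong not (sym x-j))
  ... | no j≢j | _         | _   = ⊥-elim (j≢j refl)

parity : (ℕ → Bool) → ℕ → ℕ → Bool
parity c zero    i = false
parity c (suc k) i = c i xor parity c k (suc i)

parity-cong : {c c′ : ℕ → Bool} (k i : ℕ) → (∀ j → i ≤ j → c j ≡ c′ j) →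
  parity c k i ≡ parity c′ k i
parity-cong zero    i eq = refl
parity-cong (suc k) i eq =
  cong₂ _xor_ (eq i ℕₚ.≤-refl) (parity-cong k (suc i) (λ j i<j → eq j (ℕₚ.<⇒≤ i<j)))

b2z-xor : ∀ a b → b2z a ℤ.+ (1ℤ ℤ.- two ℤ.* b2z a) ℤ.* b2z b ≡ b2z (a xor b)
b2z-xor true  true  = refl
b2z-xor true  false = refl
b2z-xor false true  = refl
b2z-xor false false = refl

αaux≡parity : (x : ℕ → ℤ) (c : ℕ → Bool) → (∀ k → x k ≡ b2z (c k)) →
  ∀ k i → αaux x k i ≡ b2z (parity c k i)
αaux≡parity x c x≡c zero    i = refl
αaux≡parity x c x≡c (suc k) i =
  trans (cong₂ (λ a t → a ℤ.+ (1ℤ ℤ.- two ℤ.* a) ℤ.* t) (x≡c i) (αaux≡parity x c x≡c k (suc i)))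
        (b2z-xor (c i) (parity c k (suc i)))

b2z-x-x²≡0 : ∀ b → b2z b ℤ.- b2z b ℤ.* b2z b ≡ 0ℤ
b2z-x-x²≡0 true  = refl
b2z-x-x²≡0 false = refl

β≡0 : (x : ℕ → ℤ) (i : ℕ) (b : Bool) → x i ≡ b2z b → β x i ≡ 0ℤ
β≡0 x i b xi≡b = begin
  two ℤ.^ i ℤ.* (x i ℤ.- x i ℤ.* x i) ℤ.* R  ≡⟨ cong (λ t → two ℤ.^ i ℤ.* (t ℤ.- t ℤ.* t) ℤ.* R) xi≡b ⟩
  two ℤ.^ i ℤ.* (b2z b ℤ.- b2z b ℤ.* b2z b) ℤ.* R  ≡⟨ cong (λ t → two ℤ.^ i ℤ.* t ℤ.* R) (b2z-x-x²≡0 b) ⟩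
  two ℤ.^ i ℤ.* 0ℤ ℤ.* R                      ≡⟨ cong (ℤ._* R) (ℤₚ.*-zeroʳ (two ℤ.^ i)) ⟩
  0ℤ                                          ∎
  where
  open ≡-Reasoning
  R = 1ℤ ℤ.- x (i ∸ 1) ℤ.+ sumFrom x 1 (i ∸ 2)

-- suffixParity n c i = c i ⊕ ⋯ ⊕ c n, i.e. α_{n,i} at a vertex.
suffixParity : ℕ → (ℕ → Bool) → ℕ → Bool
suffixParity n c i = parity c (suc n ∸ i) i

suffixParity-step : (n : ℕ) (c : ℕ → Bool) {i : ℕ} → i ≤ n →
  suffixParity n c i ≡ c i xor suffixParity n c (suc i)
suffixParity-step n c {i} i≤n = cong (λ k → parity c k i) (ℕₚ.+-∸-assoc 1 i≤n)

suffixParity-flip : (n : ℕ) {c c′ : ℕ → Bool} {p : ℕ} → p ≤ n → DiffersOnlyAt c c′ p →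
  suffixParity n c′ p ≡ not (suffixParity n c p)
suffixParity-flip n {c} {c′} {p} p≤n (same , flipped) = begin
  suffixParity n c′ p                        ≡⟨ suffixParity-step n c′ p≤n ⟩
  c′ p xor suffixParity n c′ (suc p)         ≡⟨ cong₂ _xor_ flipped (parity-cong (n ∸ p) (suc p) above) ⟩
  not (c p) xor suffixParity n c (suc p)     ≡⟨ not-distribˡ-xor (c p) _ ⟨
  not (c p xor suffixParity n c (suc p))     ≡⟨ cong not (suffixParity-step n c p≤n) ⟨
  not (suffixParity n c p)                   ∎
  where
  open ≡-Reasoning
  above : ∀ j → suc p ≤ j → c′ j ≡ c j
  above j p<j = same j (λ j≡p → ℕₚ.<-irrefl (sym j≡p) p<j)

suffixParity-above : (n : ℕ) {c c′ : ℕ → Bool} {p : ℕ} → DiffersOnlyAt c c′ p →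
  ∀ i → p < i → suffixParity n c′ i ≡ suffixParity n c i
suffixParity-above n (same , _) i p<i =
  parity-cong (suc n ∸ i) i (λ j i≤j → same j (λ j≡p → ℕₚ.<-irrefl (sym j≡p) (ℕₚ.<-≤-trans p<i i≤j)))

bitValue : Bool → ℕ
bitValue true  = 1
bitValue false = 0

binary : (ℕ → Bool) → ℕ → ℕ
binary a zero    = 0
binary a (suc m) = binary a m + 2 ^ m * bitValue (a (suc m))

2^m*bitValue≤2^m : ∀ m b → 2 ^ m * bitValue b ≤ 2 ^ m
2^m*bitValue≤2^m m true  = ℕₚ.≤-reflexive (ℕₚ.*-identityʳ (2 ^ m))
2^m*bitValue≤2^m m false = ℕₚ.≤-trans (ℕₚ.≤-reflexive (ℕₚ.*-zeroʳ (2 ^ m))) z≤n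

binary<2^ : (a : ℕ → Bool) (m : ℕ) → binary a m < 2 ^ m
binary<2^ a zero    = s≤s z≤n
binary<2^ a (suc m) =
  ℕₚ.+-mono-<-≤ (binary<2^ a m) (ℕₚ.≤-trans (2^m*bitValue≤2^m m (a (suc m))) (ℕₚ.m≤m+n (2 ^ m) 0))

binary-<-at-leading-difference : (a a′ : ℕ → Bool) {p : ℕ} (m : ℕ) → 1 ≤ p → p ≤ m →
  (∀ i → p < i → a′ i ≡ a i) → a p ≡ false → a′ p ≡ true → binary a m < binary a′ m
binary-<-at-leading-difference a a′ zero 1≤p p≤0 _ _ _ =
  ⊥-elim (ℕₚ.<-irrefl refl (ℕₚ.<-≤-trans 1≤p p≤0))
binary-<-at-leading-difference a a′ {p} (suc m) 1≤p p≤1+m above ap a′p with p ≟ suc m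
... | yes refl rewrite ap | a′p = begin-strict
  binary a m + 2 ^ m * 0    ≡⟨ cong (λ t → binary a m + t) (ℕₚ.*-zeroʳ (2 ^ m)) ⟩
  binary a m + 0            ≡⟨ ℕₚ.+-identityʳ (binary a m) ⟩
  binary a m                <⟨ binary<2^ a m ⟩
  2 ^ m                     ≡⟨ ℕₚ.*-identityʳ (2 ^ m) ⟨
  2 ^ m * 1                 ≤⟨ ℕₚ.m≤n+m (2 ^ m * 1) (binary a′ m) ⟩
  binary a′ m + 2 ^ m * 1   ∎
  where open ℕₚ.≤-Reasoning
... | no p≢1+m = ℕₚ.+-mono-<-≤
  (binary-<-at-leading-difference a a′ m 1≤p (ℕₚ.≤-pred p<1+m) above ap a′p)
  (ℕₚ.≤-reflexive (cong (λ b → 2 ^ m * bitValue b) (sym (above (suc m) p<1+m))))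
  where p<1+m = ℕₚ.≤∧≢⇒< p≤1+m p≢1+m

sumFrom-cong : {f g : ℕ → ℤ} (a k : ℕ) → (∀ i → f i ≡ g i) → sumFrom f a k ≡ sumFrom g a k
sumFrom-cong a zero    f≡g = refl
sumFrom-cong a (suc k) f≡g = cong₂ ℤ._+_ (f≡g a) (sumFrom-cong (suc a) k f≡g)

sumFrom-snoc : (f : ℕ → ℤ) (a k : ℕ) → sumFrom f a (suc k) ≡ sumFrom f a k ℤ.+ f (a + k)
sumFrom-snoc f a zero    = trans (ℤₚ.+-comm (f a) 0ℤ) (cong (λ t → 0ℤ ℤ.+ f t) (sym (ℕₚ.+-identityʳ a)))
sumFrom-snoc f a (suc k) = begin
  f a ℤ.+ sumFrom f (suc a) (suc k)                ≡⟨ cong (λ t → f a ℤ.+ t) (sumFrom-snoc f (suc a) k) ⟩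
  f a ℤ.+ (sumFrom f (suc a) k ℤ.+ f (suc a + k))  ≡⟨ ℤₚ.+-assoc (f a) _ _ ⟨
  sumFrom f a (suc k) ℤ.+ f (suc a + k)            ≡⟨ cong (λ t → sumFrom f a (suc k) ℤ.+ f t) (ℕₚ.+-suc a k) ⟨
  sumFrom f a (suc k) ℤ.+ f (a + suc k)            ∎
  where open ≡-Reasoning

two^≡+2^ : ∀ m → two ℤ.^ m ≡ + (2 ^ m)
two^≡+2^ zero    = refl
two^≡+2^ (suc m) = trans (cong (two ℤ.*_) (two^≡+2^ m)) (sym (ℤₚ.pos-* 2 (2 ^ m)))

b2z≡+bitValue : ∀ b → b2z b ≡ + bitValue b
b2z≡+bitValue true  = refl
b2z≡+bitValue false = refl

sumFrom-binary : (a : ℕ → Bool) (m : ℕ) →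
  sumFrom (λ i → two ℤ.^ (i ∸ 1) ℤ.* b2z (a i)) 1 m ≡ + binary a m
sumFrom-binary a zero    = refl
sumFrom-binary a (suc m) = begin
  sumFrom f 1 (suc m)                                      ≡⟨ sumFrom-snoc f 1 m ⟩
  sumFrom f 1 m ℤ.+ two ℤ.^ m ℤ.* b2z (a (suc m))           ≡⟨ cong₂ ℤ._+_ (sumFrom-binary a m)
                                                               (cong₂ ℤ._*_ (two^≡+2^ m) (b2z≡+bitValue (a (suc m)))) ⟩
  + binary a m ℤ.+ + (2 ^ m) ℤ.* + bitValue (a (suc m))    ≡⟨ cong (λ t → + binary a m ℤ.+ t) (ℤₚ.pos-* (2 ^ m) _) ⟨
  + binary a m ℤ.+ + (2 ^ m * bitValue (a (suc m)))        ≡⟨ ℤₚ.pos-+ (binary a m) _ ⟨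
  + binary a (suc m)                                       ∎
  where
  open ≡-Reasoning
  f = λ i → two ℤ.^ (i ∸ 1) ℤ.* b2z (a i)

F≡binary-suffixParity : (n : ℕ) (x : Vertex n) → F n x ≡ + binary (suffixParity n (bit x)) n
F≡binary-suffixParity n x =
  trans (sumFrom-cong 1 n summand≡digit) (sumFrom-binary (suffixParity n (bit x)) n)
  where
  summand≡digit : ∀ i → two ℤ.^ (i ∸ 1) ℤ.* α n (coord x) i ℤ.- β (coord x) i
                      ≡ two ℤ.^ (i ∸ 1) ℤ.* b2z (suffixParity n (bit x) i)
  summand≡digit i =
    trans (cong₂ (λ s t → two ℤ.^ (i ∸ 1) ℤ.* s ℤ.- t)
                 (αaux≡parity (coord x) (bit x) (coord≡b2z∘bit x) (suc n ∸ i) i)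
                 (β≡0 (coord x) i (bit x i) (coord≡b2z∘bit x i)))
          (ℤₚ.+-identityʳ _)

F-<-at-zero-suffixParity : (n : ℕ) (x y : Vertex n) {p : ℕ} → 1 ≤ p → p ≤ n →
  DiffersOnlyAt (bit x) (bit y) p → suffixParity n (bit x) p ≡ false → F n x ℤ.< F n y
F-<-at-zero-suffixParity n x y 1≤p p≤n differs αp≡false
  rewrite F≡binary-suffixParity n x | F≡binary-suffixParity n y =
  +<+ (binary-<-at-leading-difference (suffixParity n (bit x)) (suffixParity n (bit y)) n 1≤p p≤n
        (suffixParity-above n differs) αp≡false
        (trans (suffixParity-flip n p≤n differs) (cong not αp≡false)))

F-<-flipAt : (n : ℕ) (x : Vertex n) (j : Fin n) →
  suffixParity n (bit x) (suc (toℕ j)) ≡ false → F n x ℤ.< F n (flipAt x j)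
F-<-flipAt n x j = F-<-at-zero-suffixParity n x (flipAt x j) (s≤s z≤n) (Finₚ.toℕ<n j) (bit-flipAt x j)

F->-flipAt : (n : ℕ) (x : Vertex n) (j : Fin n) →
  suffixParity n (bit x) (suc (toℕ j)) ≡ true → F n (flipAt x j) ℤ.< F n x
F->-flipAt n x j αp≡true =
  F-<-at-zero-suffixParity n (flipAt x j) x (s≤s z≤n) (Finₚ.toℕ<n j) (differsOnlyAt-sym (bit-flipAt x j))
    (trans (suffixParity-flip n (Finₚ.toℕ<n j) (bit-flipAt x j)) (cong not αp≡true))

F-flipAt-≢ : (n : ℕ) (x : Vertex n) (j : Fin n) → F n x ≢ F n (flipAt x j)
F-flipAt-≢ n x j with suffixParity n (bit x) (suc (toℕ j)) in αp
... | false = ℤₚ.<⇒≢ (F-<-flipAt n x j αp)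
... | true  = λ eq → ℤₚ.<⇒≢ (F->-flipAt n x j αp) (sym eq)

greatest : {n : ℕ} (I : Subset n) → Nonempty I → ∃ λ i → i ∈ I × (∀ k → toℕ i < toℕ k → k ∉ I)
greatest (_ ∷ I) nonempty with nonempty? I
... | yes neI with greatest I neI
...   | i , i∈I , above = Fin.suc i , there i∈I ,
        λ { Fin.zero () ; (Fin.suc k) (s≤s i<k) (there k∈I) → above k i<k k∈I }
greatest (_ ∷ I) (Fin.zero , here) | no ¬neI =
  Fin.zero , here , λ { Fin.zero () ; (Fin.suc k) _ (there k∈I) → ¬neI (k , k∈I) }
greatest (_ ∷ I) (Fin.suc k , there k∈I) | no ¬neI = ⊥-elim (¬neI (k , k∈I))

bit-above-free : {n : ℕ} (I : Subset n) (δ x : Vertex n) (i : Fin n) →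
  (∀ k → toℕ i < toℕ k → k ∉ I) → InSubcube I δ x →
  ∀ k → suc (toℕ i) < k → bit x k ≡ bit δ k
bit-above-free {n} I δ x i above x∈S (suc k) (s≤s i<k) with k <? n
... | yes k<n = x∈S (fromℕ< k<n) (above (fromℕ< k<n) (subst (toℕ i <_) (sym (Finₚ.toℕ-fromℕ< k<n)) i<k))
... | no _    = refl

σF-decomposable : (n : ℕ) → Decomposable (σF n)
σF-decomposable n I δ nonempty with greatest I nonempty
... | i , i∈I , above = i , i∈I , d , λ x x∈S xi≡d → F-<-flipAt n x i (αp≡false x x∈S xi≡d)
  where
  p = suc (toℕ i)
  d = suffixParity n (bit δ) (suc p)
  αp≡false : ∀ x → InSubcube I δ x → x i ≡ d → suffixParity n (bit x) p ≡ false
  αp≡false x x∈S xi≡d = begin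
    suffixParity n (bit x) p                     ≡⟨ suffixParity-step n (bit x) (Finₚ.toℕ<n i) ⟩
    bit x p xor suffixParity n (bit x) (suc p)   ≡⟨ cong₂ _xor_ (trans (bit-suc-toℕ x i) xi≡d)
                                                      (parity-cong (n ∸ p) (suc p) (bit-above-free I δ x i above x∈S)) ⟩
    d xor d                                      ≡⟨ xor-same d ⟩
    false                                        ∎
    where open ≡-Reasoning

proposition6 : (n : ℕ) →
    ((x : Vertex n) (i : Fin n) → F n x ≢ F n (flipAt x i)) × Decomposable (σF n)
proposition6 n = F-flipAt-≢ n , σF-decomposable n
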